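{- For every assembly $X$ over $\mathcal S$, the map $\eta_X\colon X\to L(X)$ is a $\Sigma$-subobject of $L(X)$; specifically, the square with $\eta_X\colon X\to L(X)$, $X\to 1$, $1\xrightarrow{1}\Sigma$ and $\chi_X\colon L(X)\to\Sigma$ given by $\chi_X(x)=1$ for $x\in|X|$ and $\chi_X(\bot_X)=0$ is a pullback.
   Context: $\mathcal S$ is Scott's graph model $\mathcal P(\mathbb N)$ with its standard application; $\overline 1=\{1\}$ and $[U,V]$ denotes a standard coding of pairs in $\mathcal S$. An assembly is $(|X|,E_X)$ with $E_X(x)$ nonempty subsets of $\mathcal S$; morphisms are functions tracked by an element of $\mathcal S$. The Sierpinski object is $\Sigma=(\{0,1\},E_\Sigma)$ with $E_\Sigma(0)=\{\emptyset\}$, $E_\Sigma(1)=\{\{1\}\}$. A mono $U\to X$ is a $\Sigma$-subobject if it is a pullback of $1\xrightarrow{1}\Sigma$ along some morphism $X\to\Sigma$. For an assembly $X$, $L(X)$ is the assembly $(|X|\cup\{\bot_X\},E_{L(X)})$ with $\bot_X\notin|X|$, $E_{L(X)}(\bot_X)=\{\emptyset\}$, $E_{L(X)}(x)=\{[U,\overline 1]\mid U\in E_X(x)\}$, and $\eta_X\colon X\to L(X)$ is $\eta_X(x)=x$. -}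

module Defs where

open import Data.Nat using (ℕ; zero; suc; _+_; _*_; _%_; _/_)
open import Data.Bool using (Bool; true; false)
open import Data.Maybe using (Maybe; just; nothing)
open import Data.Unit using (⊤; tt)
open import Data.Empty using (⊥)
open import Data.Product using (Σ; _×_; _,_; proj₁; proj₂)
open import Data.Sum using (_⊎_)
open import Relation.Binary.PropositionalEquality using (_≡_)

-- Scott's graph model S = P(ℕ): subsets of ℕ as predicates,
-- with extensional equality.

S : Set₁
S = ℕ → Set

_≐_ : S → S → Set
U ≐ V = ∀ n → (U n → V n) × (V n → U n)

∅ : S
∅ _ = ⊥

one̅ : S
one̅ n = n ≡ 1

bitSet : ℕ → ℕ → Set
bitSet n zero    = n % 2 ≡ 1
bitSet n (suc k) = bitSet (n / 2) k

-- k ∈ e_n  (standard enumeration of finite sets via binary expansion)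
_∈e_ : ℕ → ℕ → Set
k ∈e n = bitSet n k

-- Cantor pairing ⟨n,m⟩ = (n+m)(n+m+1)/2 + m
tri : ℕ → ℕ
tri zero    = zero
tri (suc k) = suc k + tri k

⟨_,_⟩ : ℕ → ℕ → ℕ
⟨ n , m ⟩ = tri (n + m) + m

_·_ : S → S → S
(f · x) m = Σ ℕ λ n → (∀ k → k ∈e n → x k) × f ⟨ n , m ⟩

[_,_] : S → S → S
[ U , V ] k = (Σ ℕ λ j → (k ≡ 2 * j) × U j) ⊎ (Σ ℕ λ j → (k ≡ suc (2 * j)) × V j)

record Assembly : Set₂ where
  field
    Car      : Set
    E        : Car → S → Set₁
    nonempty : ∀ x → Σ S λ a → E x a
    -- realizer sets are sets of elements of S, hence closed under
    -- extensional equality of subsets of ℕ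
    ext      : ∀ x {a b} → a ≐ b → E x a → E x b
open Assembly public

Tracks : (X Y : Assembly) → (Car X → Car Y) → S → Set₁
Tracks X Y f r = ∀ x a → E X x a → E Y (f x) (r · a)

Tracked : (X Y : Assembly) → (Car X → Car Y) → Set₁
Tracked X Y f = Σ S λ r → Tracks X Y f r

Hom : Assembly → Assembly → Set₁
Hom X Y = Σ (Car X → Car Y) λ f → Tracked X Y f

𝟙 : Assembly
𝟙 = record
  { Car = ⊤ ; E = λ _ _ → Data.Unit.Polymorphic.⊤
  ; nonempty = λ _ → ∅ , _ ; ext = λ _ _ _ → _ }
  where import Data.Unit.Polymorphic

-- Sierpinski object Σ ; false = 0, true = 1
SigmaA : Assembly
SigmaA = record
  { Car = Bool
  ; E = E'
  ; nonempty = ne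
  ; ext = ex }
  where
  import Level
  E' : Bool → S → Set₁
  E' false U = Level.Lift (Level.suc Level.zero) (U ≐ ∅)
  E' true  U = Level.Lift (Level.suc Level.zero) (U ≐ one̅)
  ne : ∀ x → Σ S λ a → E' x a
  ne false = ∅ , Level.lift (λ n → (λ z → z) , (λ z → z))
  ne true  = one̅ , Level.lift (λ n → (λ z → z) , (λ z → z))
  ex : ∀ x {a b} → a ≐ b → E' x a → E' x b
  ex false p (Level.lift q) = Level.lift (λ n → (λ z → proj₁ (q n) (proj₂ (p n) z)) , (λ z → proj₁ (p n) (proj₂ (q n) z)))
  ex true  p (Level.lift q) = Level.lift (λ n → (λ z → proj₁ (q n) (proj₂ (p n) z)) , (λ z → proj₁ (p n) (proj₂ (q n) z)))

-- L(X): carrier |X| ⊎ {⊥_X} represented as Maybe (Car X), nothing = ⊥_X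
L : Assembly → Assembly
L X = record
  { Car = Maybe (Car X)
  ; E = E'
  ; nonempty = ne
  ; ext = ex }
  where
  import Level
  E' : Maybe (Car X) → S → Set₁
  E' nothing  W = Level.Lift (Level.suc Level.zero) (W ≐ ∅)
  E' (just x) W = Σ S λ U → E X x U × Level.Lift (Level.suc Level.zero) (W ≐ [ U , one̅ ])
  refl≐ : ∀ {W} → W ≐ W
  refl≐ n = (λ z → z) , (λ z → z)
  trans≐ : ∀ {A B C} → A ≐ B → B ≐ C → A ≐ C
  trans≐ p q n = (λ z → proj₁ (q n) (proj₁ (p n) z)) , (λ z → proj₂ (p n) (proj₂ (q n) z))
  sym≐ : ∀ {A B} → A ≐ B → B ≐ A
  sym≐ p n = proj₂ (p n) , proj₁ (p n)
  ne : ∀ x → Σ S λ a → E' x a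
  ne nothing  = ∅ , Level.lift refl≐
  ne (just x) = [ proj₁ (nonempty X x) , one̅ ] , proj₁ (nonempty X x) , proj₂ (nonempty X x) , Level.lift refl≐
  ex : ∀ x {a b} → a ≐ b → E' x a → E' x b
  ex nothing  p (Level.lift q) = Level.lift (trans≐ (sym≐ p) q)
  ex (just x) p (U , e , Level.lift q) = U , e , Level.lift (trans≐ (sym≐ p) q)

η : (X : Assembly) → Car X → Car (L X)
η X x = just x

χ : (X : Assembly) → Car (L X) → Bool
χ X (just _) = true
χ X nothing  = false

!_ : (X : Assembly) → Car X → ⊤
(! X) _ = tt

pt1 : ⊤ → Bool
pt1 _ = true

-- Pullback squares in the category of assemblies.
-- Morphisms are equal iff their underlying functions are (pointwise) equal.
--
--      A --f--> B
--      |        |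
--      g        h
--      v        v
--      C --k--> D

IsPullback : (A B C D : Assembly)
  → (Car A → Car B) → (Car A → Car C) → (Car B → Car D) → (Car C → Car D) → Set₂
IsPullback A B C D f g h k =
  (∀ a → h (f a) ≡ k (g a)) ×
  (∀ (Z : Assembly) (p : Hom Z B) (q : Hom Z C) →
     (∀ z → h (proj₁ p z) ≡ k (proj₁ q z)) →
     Σ (Hom Z A) λ u →
       (∀ z → f (proj₁ u z) ≡ proj₁ p z) ×
       (∀ z → g (proj₁ u z) ≡ proj₁ q z) ×
       (∀ (u' : Hom Z A) →
          (∀ z → f (proj₁ u' z) ≡ proj₁ p z) →
          (∀ z → g (proj₁ u' z) ≡ proj₁ q z) →
          ∀ z → proj₁ u' z ≡ proj₁ u z))

module Submission where

-- Every relation P between finite-set codes and outputs has a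
-- graph in S, and applying it to a looks up P on the finite subsets of a.
-- With Cantor pairing injective and e_(2^j) = {j}, this yields four small
-- combinators: a constant map, the map x ↦ [x, V], a test for membership of a
-- fixed number, and reindexing of the output of a given realizer.  They track
-- η, 1, χ and the mediating morphism respectively.
--
-- A map p : Z → L X with χ ∘ p = 1 lands in |X|, so it
-- factors through η as a function; the factorisation is tracked because a
-- realizer [U, 1̄] of η x yields the realizer U of x by reading its even part.
-- Uniqueness holds because η is injective.

open import Defs

open import Data.Nat using (ℕ; zero; suc; _+_; _*_; _^_; _≤_; _<_; z≤n; s≤s; _%_; _/_)
open import Data.Nat.Properties
open import Data.Nat.DivMod using (m*n%n≡0; m*n/n≡m)
open import Data.Maybe using (Maybe; just; nothing)
open import Data.Maybe.Properties using (just-injective)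
open import Data.Bool using (true)
open import Data.Empty using (⊥-elim)
open import Data.Product using (Σ; _×_; _,_; proj₁; proj₂)
open import Data.Sum using (_⊎_; inj₁; inj₂)
open import Relation.Nullary using (¬_)
open import Relation.Binary.PropositionalEquality
  using (_≡_; refl; sym; trans; cong; subst)
open import Relation.Binary using (tri<; tri≈; tri>)
open import Level using (lift)

tri-mono : ∀ {s s'} → s ≤ s' → tri s ≤ tri s'
tri-mono {zero}  _       = z≤n
tri-mono (s≤s s≤s') = +-mono-≤ (s≤s s≤s') (tri-mono s≤s')

-- The codes ⟨n,m⟩ on the diagonal n + m = s lie in [tri s, tri (s+1)),
-- so codes on a strictly lower diagonal are strictly smaller.
diagonal-below : ∀ s s' m m' → m ≤ s → s < s' → tri s + m < tri s' + m'
diagonal-below s s' m m' m≤s s<s' = begin-strict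
  tri s + m   ≤⟨ +-monoʳ-≤ (tri s) m≤s ⟩
  tri s + s   ≡⟨ +-comm (tri s) s ⟩
  s + tri s   <⟨ n<1+n (s + tri s) ⟩
  tri (suc s) ≤⟨ tri-mono s<s' ⟩
  tri s'      ≤⟨ m≤m+n (tri s') m' ⟩
  tri s' + m' ∎
  where open ≤-Reasoning

same-diagonal : ∀ s s' m m' → m ≤ s → m' ≤ s' → tri s + m ≡ tri s' + m' → s ≡ s'
same-diagonal s s' m m' m≤s m'≤s' eq with <-cmp s s'
... | tri< s<s' _ _ = ⊥-elim (<-irrefl eq (diagonal-below s s' m m' m≤s s<s'))
... | tri≈ _ s≡s' _ = s≡s'
... | tri> _ _ s>s' = ⊥-elim (<-irrefl (sym eq) (diagonal-below s' s m' m m'≤s' s>s'))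

pair-injective : ∀ {n m n' m'} → ⟨ n , m ⟩ ≡ ⟨ n' , m' ⟩ → n ≡ n' × m ≡ m'
pair-injective {n} {m} {n'} {m'} eq = n≡n' , m≡m'
  where
  sums : n + m ≡ n' + m'
  sums = same-diagonal (n + m) (n' + m') m m' (m≤n+m m n) (m≤n+m m' n') eq
  m≡m' : m ≡ m'
  m≡m' = +-cancelˡ-≡ (tri (n + m)) m m' (trans eq (cong (λ s → tri s + m') (sym sums)))
  n≡n' : n ≡ n'
  n≡n' = +-cancelʳ-≡ m n n' (trans sums (cong (n' +_) (sym m≡m')))

_⊆ₑ_ : ℕ → S → Set
n ⊆ₑ a = ∀ k → k ∈e n → a k

∉e-0 : ∀ k → ¬ (k ∈e 0)
∉e-0 zero    ()
∉e-0 (suc k) k∈e0 = ∉e-0 k k∈e0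

0⊆ₑ : ∀ a → 0 ⊆ₑ a
0⊆ₑ a k k∈e0 = ⊥-elim (∉e-0 k k∈e0)

bits-double : ∀ x k → bitSet (2 * x) (suc k) ≡ bitSet x k
bits-double x k = cong (λ y → bitSet y k) (trans (cong (_/ 2) (*-comm 2 x)) (m*n/n≡m x 2))

∈e-2^-only : ∀ j k → k ∈e (2 ^ j) → k ≡ j
∈e-2^-only zero    zero    _ = refl
∈e-2^-only zero    (suc k) k∈ = ⊥-elim (∉e-0 k k∈)
∈e-2^-only (suc j) zero    odd =
  ⊥-elim (0≢1+n (trans (sym (m*n%n≡0 (2 ^ j) 2)) (trans (cong (_% 2) (*-comm (2 ^ j) 2)) odd)))
∈e-2^-only (suc j) (suc k) k∈ =
  cong suc (∈e-2^-only j k (subst (λ P → P) (bits-double (2 ^ j) k) k∈))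

∈e-2^ : ∀ j → j ∈e (2 ^ j)
∈e-2^ zero    = refl
∈e-2^ (suc j) = subst (λ P → P) (sym (bits-double (2 ^ j) j)) (∈e-2^ j)

2^⊆ₑ : ∀ {a} j → a j → (2 ^ j) ⊆ₑ a
2^⊆ₑ {a} j aj k k∈ = subst a (sym (∈e-2^-only j k k∈)) aj

≐-sym : ∀ {A B} → A ≐ B → B ≐ A
≐-sym A≐B n = proj₂ (A≐B n) , proj₁ (A≐B n)

[]-even : ∀ U V k → [ U , V ] (2 * k) → U k
[]-even U V k (inj₁ (j , 2k≡2j , Uj)) = subst U (sym (*-cancelˡ-≡ k j 2 2k≡2j)) Uj
[]-even U V k (inj₂ (j , 2k≡2j+1 , _)) = ⊥-elim (even≢odd k j 2k≡2j+1)

even-part : ∀ {W U V} → W ≐ [ U , V ] → U ≐ (λ k → W (2 * k))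
even-part {W} {U} {V} W≐UV k =
  (λ Uk → proj₂ (W≐UV (2 * k)) (inj₁ (k , refl , Uk))) ,
  (λ W2k → []-even U V k (proj₁ (W≐UV (2 * k)) W2k))

graph : (ℕ → ℕ → Set) → S
graph P k = Σ ℕ λ n → Σ ℕ λ m → (k ≡ ⟨ n , m ⟩) × P n m

graph-·-elim : ∀ P a m → (graph P · a) m → Σ ℕ λ n → n ⊆ₑ a × P n m
graph-·-elim P a m (n , n⊆a , n' , m' , pair≡ , Pn'm') with pair-injective {n} {m} {n'} {m'} pair≡
... | refl , refl = n , n⊆a , Pn'm'

graph-·-intro : ∀ P a m → (Σ ℕ λ n → n ⊆ₑ a × P n m) → (graph P · a) m
graph-·-intro P a m (n , n⊆a , Pnm) = n , n⊆a , n , m , refl , Pnm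

constR : S → S
constR V = graph (λ _ m → V m)

constR-· : ∀ V a → (constR V · a) ≐ V
constR-· V a m =
  (λ r → proj₂ (proj₂ (graph-·-elim _ a m r))) ,
  (λ Vm → graph-·-intro _ a m (0 , 0⊆ₑ a , Vm))

pairR : S → S
pairR V = graph λ n m → (Σ ℕ λ j → (m ≡ 2 * j) × j ∈e n) ⊎ (Σ ℕ λ j → (m ≡ suc (2 * j)) × V j)

pairR-· : ∀ V a → (pairR V · a) ≐ [ a , V ]
pairR-· V a m = to , from
  where
  to : (pairR V · a) m → [ a , V ] m
  to r with graph-·-elim _ a m r
  ... | n , n⊆a , inj₁ (j , m≡2j , j∈n) = inj₁ (j , m≡2j , n⊆a j j∈n)
  ... | _ , _   , inj₂ right            = inj₂ right
  from : [ a , V ] m → (pairR V · a) m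
  from (inj₁ (j , m≡2j , aj)) = graph-·-intro _ a m (2 ^ j , 2^⊆ₑ j aj , inj₁ (j , m≡2j , ∈e-2^ j))
  from (inj₂ right)           = graph-·-intro _ a m (0 , 0⊆ₑ a , inj₂ right)

testR : ℕ → S → S
testR k V = graph λ n m → V m × k ∈e n

testR-∈ : ∀ k V a → a k → (testR k V · a) ≐ V
testR-∈ k V a ak m =
  (λ r → proj₁ (proj₂ (proj₂ (graph-·-elim _ a m r)))) ,
  (λ Vm → graph-·-intro _ a m (2 ^ k , 2^⊆ₑ k ak , Vm , ∈e-2^ k))

testR-∉ : ∀ k V a → ¬ a k → (testR k V · a) ≐ ∅
testR-∉ k V a ¬ak m =
  (λ r → let (n , n⊆a , _ , k∈n) = graph-·-elim _ a m r in ¬ak (n⊆a k k∈n)) ,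
  λ ()

reindexR : S → (ℕ → ℕ) → S
reindexR r f = graph λ n m → r ⟨ n , f m ⟩

reindexR-· : ∀ r f a → (reindexR r f · a) ≐ (λ m → (r · a) (f m))
reindexR-· r f a m = graph-·-elim _ a m , graph-·-intro _ a m

module _ (X : Assembly) where

  η-tracked : Tracked X (L X) (η X)
  η-tracked = pairR one̅ , λ x a a⊩x → a , a⊩x , lift (pairR-· one̅ a)

  !-tracked : Tracked X 𝟙 (! X)
  !-tracked = ∅ , λ _ _ _ → _

  -- 3 = 2·1 + 1 is the tag of the right component 1̄ of [U, 1̄]
  χ-tracked : Tracked (L X) SigmaA (χ X)
  χ-tracked = testR 3 one̅ , track
    where
    track : Tracks (L X) SigmaA (χ X) (testR 3 one̅)
    track (just x) W (U , _ , lift W≐U1) =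
      lift (testR-∈ 3 one̅ W (proj₂ (W≐U1 3) (inj₂ (1 , refl , refl))))
    track nothing  W (lift W≐∅) = lift (testR-∉ 3 one̅ W (proj₁ (W≐∅ 3)))

pt1-tracked : Tracked 𝟙 SigmaA pt1
pt1-tracked = constR one̅ , λ _ a _ → lift (constR-· one̅ a)

module _ (X : Assembly) where

  defined : (m : Car (L X)) → χ X m ≡ true → Car X
  defined (just x) _ = x
  defined nothing ()

  η-defined : (m : Car (L X)) (χm≡1 : χ X m ≡ true) → η X (defined m χm≡1) ≡ m
  η-defined (just x) _ = refl
  η-defined nothing ()

  realizer-even-part : (m : Car (L X)) (χm≡1 : χ X m ≡ true) (W : S) →
    E (L X) m W → E X (defined m χm≡1) (λ k → W (2 * k))
  realizer-even-part (just x) _ W (U , U⊩x , lift W≐U1) = ext X x (even-part W≐U1) U⊩x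
  realizer-even-part nothing () W

  factor : (Z : Assembly) (p : Hom Z (L X)) →
    (∀ z → χ X (proj₁ p z) ≡ true) → Hom Z X
  factor Z (p , r , r-tracks) χp≡1 = lifted , reindexR r (2 *_) , tracks
    where
    lifted : Car Z → Car X
    lifted z = defined (p z) (χp≡1 z)
    tracks : Tracks Z X lifted (reindexR r (2 *_))
    tracks z a a⊩z = ext X (lifted z) (≐-sym (reindexR-· r (2 *_) a))
      (realizer-even-part (p z) (χp≡1 z) (r · a) (r-tracks z a a⊩z))

  -- the square commutes, and by factor every cone factors through it,
  -- uniquely since η is injective
  η-χ-pullback : IsPullback X (L X) 𝟙 SigmaA (η X) (! X) (χ X) pt1
  η-χ-pullback = (λ _ → refl) , λ Z p _ χp≡1 →
    factor Z p χp≡1 ,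
    (λ z → η-defined (proj₁ p z) (χp≡1 z)) ,
    (λ _ → refl) ,
    (λ u' ηu'≡p _ z → just-injective (trans (ηu'≡p z) (sym (η-defined (proj₁ p z) (χp≡1 z)))))

lemma5p9 : (X : Assembly) →
    Tracked X (L X) (η X) × Tracked X 𝟙 (! X) × Tracked 𝟙 SigmaA pt1 ×
    Tracked (L X) SigmaA (χ X) ×
    IsPullback X (L X) 𝟙 SigmaA (η X) (! X) (χ X) pt1
lemma5p9 X = η-tracked X , !-tracked X , pt1-tracked , χ-tracked X , η-χ-pullback X
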